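{- For every connected weighted graph $(G,\mathbf{w})$ with at least $3$ vertices, $c(G,\mathbf{w}) \leq \left\lceil \frac{h_c(G,\mathbf{w})}{2}\right\rceil$.
   Context: A weighted graph $(G,\mathbf{w})$ is a finite simple graph with positive integer edge weights that is weight-minimal: every edge is a shortest path between its endpoints. $d_\mathbf{w}(u,v)$ is the minimum total weight of a $(u,v)$-path. A binary addressing of length $m$ is a map $f:V(G)\to\{0,1\}^m$ with $d_\mathbf{w}(u,v)\le d_H(f(u),f(v))$ for all $u,v$ ($d_H$ the Hamming distance); $c(G,\mathbf{w})$ is the minimum such $m$. $h_c(G,\mathbf{w})$ is the minimum total weight of a Hamilton cycle in the complete graph on $V(G)$ in which the edge $uv$ has weight $d_\mathbf{w}(u,v)$. -}

module Defs where

open import Data.Nat using (ℕ; zero; suc; _+_; _≤_)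
open import Data.Bool using (Bool; true; false; T; _≟_)
open import Data.Fin using (Fin)
open import Data.Vec using (Vec; []; _∷_)
open import Data.List using (List; []; _∷_; allFin)
open import Data.List.Relation.Unary.Unique.Propositional using (Unique)
open import Data.List.Relation.Binary.Permutation.Propositional using (_↭_)
open import Data.Product using (Σ; _×_; ∃)
open import Relation.Nullary using (¬_; yes; no)
open import Relation.Binary.PropositionalEquality using (_≡_)

record WGraph (n : ℕ) : Set where
  field
    adj    : Fin n → Fin n → Bool
    adj-sym   : ∀ u v → adj u v ≡ adj v u
    adj-irrefl : ∀ u → adj u u ≡ false
    w      : Fin n → Fin n → ℕ       -- only values on edges matter
    w-sym  : ∀ u v → T (adj u v) → w u v ≡ w v u
    w-pos  : ∀ u v → T (adj u v) → 1 ≤ w u v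

module _ {n : ℕ} (G : WGraph n) where
  open WGraph G

  data Walk : Fin n → Fin n → Set where
    [] : ∀ {u} → Walk u u
    _∷_ : ∀ {u x v} → T (adj u x) → Walk x v → Walk u v

  vertices : ∀ {u v} → Walk u v → List (Fin n)
  vertices {u} [] = u ∷ []
  vertices {u} (e ∷ p) = u ∷ vertices p

  weight : ∀ {u v} → Walk u v → ℕ
  weight [] = 0
  weight (_∷_ {u} {x} e p) = w u x + weight p

  IsPath : ∀ {u v} → Walk u v → Set
  IsPath p = Unique (vertices p)

  Connected : Set
  Connected = ∀ u v → Σ (Walk u v) IsPath

  WeightMinimal : Set
  WeightMinimal = ∀ u v → T (adj u v) → (p : Walk u v) → IsPath p → w u v ≤ weight p

  IsDistance : (Fin n → Fin n → ℕ) → Set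
  IsDistance D = ∀ u v →
    (Σ (Walk u v) λ p → IsPath p × weight p ≡ D u v)
    × ((p : Walk u v) → IsPath p → D u v ≤ weight p)

hamming : ∀ {m} → Vec Bool m → Vec Bool m → ℕ
hamming [] [] = 0
hamming (a ∷ as) (b ∷ bs) with a ≟ b
... | yes _ = hamming as bs
... | no _ = suc (hamming as bs)

IsAddressing : ∀ {n m} → (Fin n → Fin n → ℕ) → (Fin n → Vec Bool m) → Set
IsAddressing D f = ∀ u v → D u v ≤ hamming (f u) (f v)

cycleCost : ∀ {n} → (Fin n → Fin n → ℕ) → List (Fin n) → ℕ
cycleCost D [] = 0
cycleCost D (x ∷ xs) = go x xs
  where
  go : _ → List _ → ℕ
  go prev [] = D prev x
  go prev (y ∷ ys) = D prev y + go y ys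

-- a Hamilton cycle of the complete graph on Fin n: an ordering of all vertices
IsHamiltonCycle : ∀ {n} → List (Fin n) → Set
IsHamiltonCycle {n} vs = vs ↭ allFin n

IsMinHamiltonCost : ∀ {n} → (Fin n → Fin n → ℕ) → ℕ → Set
IsMinHamiltonCost {n} D h =
  (Σ (List (Fin n)) λ vs → IsHamiltonCycle vs × cycleCost D vs ≡ h)
  × ((vs : List (Fin n)) → IsHamiltonCycle vs → h ≤ cycleCost D vs)

{-# OPTIONS --safe #-}
module Submission where

-- Walk once around a Hamilton cycle of D-cost h and record the time at which each vertex
-- is reached.  On a circle of circumference 2K ≥ h, where K = ⌈h/2⌉, the distance D u v
-- is at most the length of either arc between the times of u and v, by the triangle
-- inequality along the cycle.  The cycle of length 2K embeds isometrically in the K-cube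
-- (walking around it, the bits are switched on one by one and then off in the same order),
-- so the codes of the arrival times form a binary addressing of length K.

open import Defs
open import Data.Bool using (Bool; true; false; not; T)
open import Data.Empty using (⊥-elim)
open import Data.Fin using (Fin; _≟_)
open import Data.List using (List; []; _∷_)
open import Data.List.Membership.Propositional using (_∈_)
open import Data.List.Membership.Propositional.Properties using (∈-allFin; ∉[])
open import Data.List.Relation.Binary.Permutation.Propositional using (↭-sym)
open import Data.List.Relation.Binary.Permutation.Propositional.Properties using (∈-resp-↭)
open import Data.List.Relation.Unary.All.Properties using (¬Any⇒All¬)
open import Data.List.Relation.Unary.All using ([])
open import Data.List.Relation.Unary.AllPairs using ([]; _∷_)
open import Data.List.Relation.Unary.Any using (here; there)
open import Data.Nat using (ℕ; zero; suc; _+_; _∸_; _≤_; _<_; _<?_; z≤n; s≤s; ⌈_/2⌉)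
open import Data.Nat.Properties
  using ( +-assoc; +-comm; +-suc; +-identityʳ; +-commutativeSemigroup
        ; ≤-refl; ≤-reflexive; ≤-trans; ≤-antisym; ≤-total; <⇒≤; ≤-<-trans; ≮⇒≥; n≤0⇒n≡0
        ; +-monoˡ-≤; +-monoʳ-≤; +-cancelˡ-≤; +-cancelʳ-≤; m≤n+m; m+n≤o⇒n≤o; m+n≮m
        ; m+n∸m≡n; m≤n⇒∃[o]m+o≡n; ⌊n/2⌋≤⌈n/2⌉; ⌊n/2⌋+⌈n/2⌉≡n; module ≤-Reasoning )
open import Algebra.Properties.CommutativeSemigroup +-commutativeSemigroup using (x∙yz≈y∙xz; x∙yz≈yx∙z)
open import Data.Product using (Σ; ∃; _×_; _,_; proj₁; proj₂; map₂)
open import Data.Sum using (_⊎_; inj₁; inj₂)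
import Data.Sum as Sum
open import Data.Vec using (Vec; []; _∷_; map)
open import Function using (_∘_)
open import Function.Metric.Nat.Definitions using (Definite; Symmetric; TriangleInequality)
open import Relation.Binary.PropositionalEquality
open import Relation.Nullary using (yes; no; contradiction)

module WalkOperations {n : ℕ} (G : WGraph n) where
  open WGraph G
  open import Data.List.Membership.DecPropositional (_≟_ {n}) using (_∈?_)

  infixr 5 _++ʷ_

  _++ʷ_ : ∀ {u x v} → Walk G u x → Walk G x v → Walk G u v
  []      ++ʷ q = q
  (e ∷ p) ++ʷ q = e ∷ (p ++ʷ q)

  weight-++ʷ : ∀ {u x v} (p : Walk G u x) (q : Walk G x v) →
               weight G (p ++ʷ q) ≡ weight G p + weight G q
  weight-++ʷ []                 q = refl
  weight-++ʷ (_∷_ {u} {y} e p) q =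
    trans (cong (w u y +_) (weight-++ʷ p q)) (sym (+-assoc (w u y) (weight G p) (weight G q)))

  reverseʷ : ∀ {u v} → Walk G u v → Walk G v u
  reverseʷ []                = []
  reverseʷ (_∷_ {u} {x} e p) = reverseʷ p ++ʷ (subst T (adj-sym u x) e ∷ [])

  weight-reverseʷ : ∀ {u v} (p : Walk G u v) → weight G (reverseʷ p) ≡ weight G p
  weight-reverseʷ []                = refl
  weight-reverseʷ (_∷_ {u} {x} e p) = begin
    weight G (reverseʷ p ++ʷ (e′ ∷ []))  ≡⟨ weight-++ʷ (reverseʷ p) (e′ ∷ []) ⟩
    weight G (reverseʷ p) + (w x u + 0)  ≡⟨ cong₂ _+_ (weight-reverseʷ p) (+-identityʳ (w x u)) ⟩
    weight G p + w x u                   ≡⟨ cong (weight G p +_) (w-sym u x e) ⟨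
    weight G p + w u x                   ≡⟨ +-comm (weight G p) (w u x) ⟩
    w u x + weight G p                   ∎
    where
    open ≡-Reasoning
    e′ = subst T (adj-sym u x) e

  suffixFrom : ∀ {x v u} (q : Walk G x v) → u ∈ vertices G q →
               Σ (Walk G u v) λ r → weight G r ≤ weight G q × (IsPath G q → IsPath G r)
  suffixFrom []      (here refl) = [] , ≤-refl , λ q-path → q-path
  suffixFrom (e ∷ q) (here refl) = e ∷ q , ≤-refl , λ q-path → q-path
  suffixFrom (_∷_ {x} {y} e q) (there u∈q) =
    let r , r≤q , r-path = suffixFrom q u∈q
    in r , ≤-trans r≤q (m≤n+m (weight G q) (w x y)) , λ { (_ ∷ q-path) → r-path q-path }

  toPath : ∀ {u v} (p : Walk G u v) → Σ (Walk G u v) λ q → IsPath G q × weight G q ≤ weight G p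
  toPath []                = [] , [] ∷ [] , z≤n
  toPath (_∷_ {u} {x} e p) with toPath p
  ... | q , q-path , q≤p with u ∈? vertices G q
  ...   | yes u∈q = let r , r≤q , r-path = suffixFrom q u∈q
                    in r , r-path q-path , ≤-trans r≤q (≤-trans q≤p (m≤n+m (weight G p) (w u x)))
  ...   | no  u∉q = e ∷ q , ¬Any⇒All¬ (vertices G q) u∉q ∷ q-path , +-monoʳ-≤ (w u x) q≤p

module Distance {n : ℕ} (G : WGraph n) (D : Fin n → Fin n → ℕ) (isD : IsDistance G D) where
  open WalkOperations G

  -- IsDistance only compares D with paths; every walk can first be shortened to one.
  distance-≤-weight : ∀ {u v} (p : Walk G u v) → D u v ≤ weight G p
  distance-≤-weight {u} {v} p =
    let q , q-path , q≤p = toPath p in ≤-trans (proj₂ (isD u v) q q-path) q≤p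

  shortest : ∀ u v → Σ (Walk G u v) λ p → weight G p ≡ D u v
  shortest u v = let p , _ , p≡D = proj₁ (isD u v) in p , p≡D

  distance-definite : Definite _≡_ D
  distance-definite {u} refl = n≤0⇒n≡0 (distance-≤-weight {u} [])

  distance-triangle : TriangleInequality D
  distance-triangle u x v =
    let p , p≡ = shortest u x ; q , q≡ = shortest x v
    in ≤-trans (distance-≤-weight (p ++ʷ q))
               (≤-reflexive (trans (weight-++ʷ p q) (cong₂ _+_ p≡ q≡)))

  distance-sym : Symmetric D
  distance-sym u v = ≤-antisym (≤-reversed u v) (≤-reversed v u)
    where
    ≤-reversed : ∀ u v → D u v ≤ D v u
    ≤-reversed u v = let p , p≡ = shortest v u
                     in ≤-trans (distance-≤-weight (reverseʷ p))
                                (≤-reflexive (trans (weight-reverseʷ p) p≡))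

thermometer : (K p : ℕ) → Vec Bool K
thermometer zero    _       = []
thermometer (suc K) zero    = false ∷ thermometer K zero
thermometer (suc K) (suc p) = true ∷ thermometer K p

hamming-comm : ∀ {m} (v w : Vec Bool m) → hamming v w ≡ hamming w v
hamming-comm []          []          = refl
hamming-comm (false ∷ v) (false ∷ w) = hamming-comm v w
hamming-comm (false ∷ v) (true  ∷ w) = cong suc (hamming-comm v w)
hamming-comm (true  ∷ v) (false ∷ w) = cong suc (hamming-comm v w)
hamming-comm (true  ∷ v) (true  ∷ w) = hamming-comm v w

hamming-map-not : ∀ {m} (v w : Vec Bool m) → hamming (map not v) (map not w) ≡ hamming v w
hamming-map-not []          []          = refl
hamming-map-not (false ∷ v) (false ∷ w) = hamming-map-not v w
hamming-map-not (false ∷ v) (true  ∷ w) = cong suc (hamming-map-not v w)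
hamming-map-not (true  ∷ v) (false ∷ w) = cong suc (hamming-map-not v w)
hamming-map-not (true  ∷ v) (true  ∷ w) = hamming-map-not v w

hamming-map-notʳ : ∀ {m} (v w : Vec Bool m) → hamming v (map not w) + hamming v w ≡ m
hamming-map-notʳ []          []          = refl
hamming-map-notʳ (false ∷ v) (false ∷ w) = cong suc (hamming-map-notʳ v w)
hamming-map-notʳ (false ∷ v) (true  ∷ w) = trans (+-suc _ _) (cong suc (hamming-map-notʳ v w))
hamming-map-notʳ (true  ∷ v) (false ∷ w) = trans (+-suc _ _) (cong suc (hamming-map-notʳ v w))
hamming-map-notʳ (true  ∷ v) (true  ∷ w) = cong suc (hamming-map-notʳ v w)

hamming-thermometer : ∀ {K p q} → p ≤ q → q ≤ K →
                      hamming (thermometer K p) (thermometer K q) + p ≡ q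
hamming-thermometer {zero}  z≤n       z≤n       = refl
hamming-thermometer {suc K} {zero} {zero}  z≤n _ = hamming-thermometer {K} z≤n z≤n
hamming-thermometer {suc K} {zero} {suc q} z≤n (s≤s q≤K) =
  cong suc (hamming-thermometer z≤n q≤K)
hamming-thermometer {suc K} {suc p} {suc q} (s≤s p≤q) (s≤s q≤K) =
  trans (+-suc _ p) (cong suc (hamming-thermometer p≤q q≤K))

-- The code of position p ≤ K + K on the cycle of length K + K.
cycleCode : (K p : ℕ) → Vec Bool K
cycleCode K p with p <? K
... | yes _ = thermometer K p
... | no  _ = map not (thermometer K (p ∸ K))

cycleCode-lower : ∀ {K p} → p < K → cycleCode K p ≡ thermometer K p
cycleCode-lower {K} {p} p<K with p <? K
... | yes _   = refl
... | no  p≮K = contradiction p<K p≮K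

cycleCode-upper : ∀ K r → cycleCode K (K + r) ≡ map not (thermometer K r)
cycleCode-upper K r with K + r <? K
... | yes K+r<K = contradiction K+r<K (m+n≮m K r)
... | no  _     = cong (map not ∘ thermometer K) (m+n∸m≡n K r)

data Half (K : ℕ) : ℕ → Set where
  lower : ∀ {p} → p < K → Half K p
  upper : ∀ {r} → r ≤ K → Half K (K + r)

half : ∀ {K p} → p ≤ K + K → Half K p
half {K} {p} p≤K+K with p <? K
... | yes p<K = lower p<K
... | no  p≮K with m≤n⇒∃[o]m+o≡n (≮⇒≥ p≮K)
...   | r , refl = upper (+-cancelˡ-≤ K r K p≤K+K)

hamming-thermometer-not : ∀ {K p r} → p ≤ K → r ≤ K →
  let B = hamming (thermometer K p) (map not (thermometer K r)) in
  B + p ≡ K + r ⊎ B + (K + r) ≡ K + K + p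
hamming-thermometer-not {K} {p} {r} p≤K r≤K = Sum.map r≤p⇒ p≤r⇒ (≤-total r p)
  where
  open ≡-Reasoning
  A = hamming (thermometer K p) (thermometer K r)
  B = hamming (thermometer K p) (map not (thermometer K r))

  B+A≡K : B + A ≡ K
  B+A≡K = hamming-map-notʳ (thermometer K p) (thermometer K r)

  r≤p⇒ : r ≤ p → B + p ≡ K + r
  r≤p⇒ r≤p = begin
    B + p        ≡⟨ cong (B +_) (trans (cong (_+ r) (hamming-comm (thermometer K p) _))
                                       (hamming-thermometer r≤p p≤K)) ⟨
    B + (A + r)  ≡⟨ +-assoc B A r ⟨
    B + A + r    ≡⟨ cong (_+ r) B+A≡K ⟩
    K + r        ∎

  p≤r⇒ : p ≤ r → B + (K + r) ≡ K + K + p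
  p≤r⇒ p≤r = begin
    B + (K + r)        ≡⟨ x∙yz≈y∙xz B K r ⟩
    K + (B + r)        ≡⟨ cong (λ t → K + (B + t)) (hamming-thermometer p≤r r≤K) ⟨
    K + (B + (A + p))  ≡⟨ cong (K +_) (+-assoc B A p) ⟨
    K + (B + A + p)    ≡⟨ cong (λ t → K + (t + p)) B+A≡K ⟩
    K + (K + p)        ≡⟨ +-assoc K K p ⟨
    K + K + p          ∎

-- The Hamming distance of two codes is the length of one of the two arcs between them.
hamming-cycleCode : ∀ {K p q} → p ≤ q → q ≤ K + K →
  let h = hamming (cycleCode K p) (cycleCode K q) in h + p ≡ q ⊎ h + q ≡ K + K + p
hamming-cycleCode {K} p≤q q≤K+K with half {K} (≤-trans p≤q q≤K+K) | half {K} q≤K+K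
... | lower p<K | lower q<K
  rewrite cycleCode-lower p<K | cycleCode-lower q<K = inj₁ (hamming-thermometer p≤q (<⇒≤ q<K))
... | lower {p} p<K | upper {r} r≤K
  rewrite cycleCode-lower p<K | cycleCode-upper K r = hamming-thermometer-not (<⇒≤ p<K) r≤K
... | upper {s} _ | lower q<K = contradiction (≤-<-trans p≤q q<K) (m+n≮m K s)
... | upper {s} _ | upper {t} t≤K
  rewrite cycleCode-upper K s | cycleCode-upper K t | hamming-map-not (thermometer K s) (thermometer K t) =
  inj₁ (trans (x∙yz≈y∙xz _ K s)
              (cong (K +_) (hamming-thermometer (+-cancelˡ-≤ K s t p≤q) t≤K)))

≤-hamming-cycleCode : ∀ {K d p q} → d + p ≤ q → d + q ≤ K + K + p → q ≤ K + K →
                      d ≤ hamming (cycleCode K p) (cycleCode K q)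
≤-hamming-cycleCode {K} {d} {p} {q} d+p≤q d+q≤K+K+p q≤K+K
  with hamming-cycleCode {K} (m+n≤o⇒n≤o d d+p≤q) q≤K+K
... | inj₁ h+p≡q      = +-cancelʳ-≤ p d _ (≤-trans d+p≤q (≤-reflexive (sym h+p≡q)))
... | inj₂ h+q≡K+K+p  = +-cancelʳ-≤ q d _ (≤-trans d+q≤K+K+p (≤-reflexive (sym h+q≡K+K+p)))

n≤⌈n/2⌉+⌈n/2⌉ : ∀ n → n ≤ ⌈ n /2⌉ + ⌈ n /2⌉
n≤⌈n/2⌉+⌈n/2⌉ n =
  subst (_≤ ⌈ n /2⌉ + ⌈ n /2⌉) (⌊n/2⌋+⌈n/2⌉≡n n) (+-monoˡ-≤ ⌈ n /2⌉ (⌊n/2⌋≤⌈n/2⌉ n))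

module Tour {ℓ} {A : Set ℓ} (D : A → A → ℕ) (D-definite : Definite _≡_ D)
            (D-triangle : TriangleInequality D) where

  walkLength : A → List A → A → ℕ
  walkLength a []       z = D a z
  walkLength a (b ∷ bs) z = D a b + walkLength b bs z

  walkLength-unique : ∀ z (g : A → List (A) → ℕ) →
    (∀ a → g a [] ≡ D a z) → (∀ a b bs → g a (b ∷ bs) ≡ D a b + g b bs) →
    ∀ a bs → g a bs ≡ walkLength a bs z
  walkLength-unique z g g-[] g-∷ a []       = g-[] a
  walkLength-unique z g g-[] g-∷ a (b ∷ bs) =
    trans (g-∷ a b bs) (cong (D a b +_) (walkLength-unique z g g-[] g-∷ b bs))

  distance-≤-walkLength : ∀ a bs z → D a z ≤ walkLength a bs z
  distance-≤-walkLength a []       z = ≤-refl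
  distance-≤-walkLength a (b ∷ bs) z =
    ≤-trans (D-triangle a b z) (+-monoʳ-≤ (D a b) (distance-≤-walkLength b bs z))

  -- (u , s) ≼ (v , t): moving at unit speed one can be at u at time s and at v at time t.
  infix 4 _≼_
  _≼_ : A × ℕ → A × ℕ → Set
  (u , s) ≼ (v , t) = D u v + s ≤ t

  ≼-refl : ∀ {e} → e ≼ e
  ≼-refl {u , s} = ≤-reflexive (cong (_+ s) (D-definite refl))

  ≼-trans : ∀ {e₁ e₂ e₃} → e₁ ≼ e₂ → e₂ ≼ e₃ → e₁ ≼ e₃
  ≼-trans {u , s} {v , t} {w , r} u≼v v≼w = begin
    D u w + s            ≤⟨ +-monoˡ-≤ s (D-triangle u v w) ⟩
    D u v + D v w + s    ≡⟨ cong (_+ s) (+-comm (D u v) (D v w)) ⟩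
    D v w + D u v + s    ≡⟨ +-assoc (D v w) (D u v) s ⟩
    D v w + (D u v + s)  ≤⟨ +-monoʳ-≤ (D v w) u≼v ⟩
    D v w + t            ≤⟨ v≼w ⟩
    r                    ∎
    where open ≤-Reasoning

  ≼-delay : ∀ {u s v t} r → (u , s) ≼ (v , t) → (u , r + s) ≼ (v , r + t)
  ≼-delay {u} {s} {v} {t} r u≼v = subst (_≤ r + t) (x∙yz≈y∙xz r (D u v) s) (+-monoʳ-≤ r u≼v)

  visits : ℕ → A → List A → List (A × ℕ)
  visits t a []       = (a , t) ∷ []
  visits t a (b ∷ bs) = (a , t) ∷ visits (D a b + t) b bs

  visits-start : ∀ {t a bs e} → e ∈ visits t a bs → (a , t) ≼ e
  visits-start {bs = []}    (here refl) = ≼-refl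
  visits-start {bs = _ ∷ _} (here refl) = ≼-refl
  visits-start {t} {a} {b ∷ bs} (there e∈) =
    ≼-trans {e₂ = b , D a b + t} ≤-refl (visits-start {bs = bs} e∈)

  visits-end : ∀ {t a bs e} z → e ∈ visits t a bs → e ≼ (z , walkLength a bs z + t)
  visits-end {bs = []}            z (here refl) = ≤-refl
  visits-end {t} {a} {bs@(_ ∷ _)} z (here refl) = +-monoˡ-≤ t (distance-≤-walkLength a bs z)
  visits-end {t} {a} {b ∷ bs} {e} z (there e∈)  =
    subst (λ s → e ≼ (z , s)) (x∙yz≈yx∙z (walkLength b bs z) (D a b) t)
          (visits-end {bs = bs} z e∈)

  visits-comparable : ∀ {t a bs e e′} → e ∈ visits t a bs → e′ ∈ visits t a bs →
                      e ≼ e′ ⊎ e′ ≼ e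
  visits-comparable {bs = []}         (here refl) (here refl) = inj₁ ≼-refl
  visits-comparable {bs = bs@(_ ∷ _)} (here refl) e′∈         = inj₁ (visits-start {bs = bs} e′∈)
  visits-comparable {bs = bs@(_ ∷ _)} (there e∈)  (here refl) = inj₂ (visits-start {bs = bs} (there e∈))
  visits-comparable {bs = _ ∷ bs}     (there e∈)  (there e′∈) = visits-comparable {bs = bs} e∈ e′∈

  visits-cover : ∀ {t a bs u} → u ∈ a ∷ bs → ∃ λ s → (u , s) ∈ visits t a bs
  visits-cover {t} {bs = []}    (here refl) = t , here refl
  visits-cover {t} {bs = _ ∷ _} (here refl) = t , here refl
  visits-cover {bs = _ ∷ bs}    (there u∈)  = map₂ there (visits-cover {bs = bs} u∈)

  -- One more round of the closed walk a, bs, a visits u again.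
  visits-wrap : ∀ {t a bs u s e} → (u , s) ∈ visits t a bs → e ∈ visits t a bs →
                e ≼ (u , walkLength a bs a + s)
  visits-wrap {a = a} {bs} u∈ e∈ =
    ≼-trans (visits-end a e∈) (≼-delay (walkLength a bs a) (visits-start u∈))

module TourAddressing {n : ℕ} (D : Fin n → Fin n → ℕ) (D-definite : Definite _≡_ D)
                      (D-sym : Symmetric D) (D-triangle : TriangleInequality D) where
  open Tour D D-definite D-triangle

  -- cycleCost runs a local function of Defs that cannot be named here: once y ∷ ys is
  -- abstracted, unification names it through the metavariable closeTour.
  mutual
    private
      closeTour : Fin n → List (Fin n) → Fin n → List (Fin n) → ℕ
      closeTour = _

    cycleCost≡walkLength : ∀ x xs → cycleCost D (x ∷ xs) ≡ walkLength x xs x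
    cycleCost≡walkLength x []       = refl
    cycleCost≡walkLength x (y ∷ ys) with y ∷ ys
    ... | tour = cong (D x y +_)
                      (walkLength-unique x (closeTour x tour) (λ _ → refl) (λ _ _ _ → refl) y ys)

  addressing-from-closed-walk : ∀ x xs → (∀ u → u ∈ x ∷ xs) →
    Σ (Fin n → Vec Bool ⌈ walkLength x xs x /2⌉) (IsAddressing D)
  addressing-from-closed-walk x xs covers = code , separated
    where
    L = walkLength x xs x
    K = ⌈ L /2⌉

    visit : ∀ u → ∃ λ s → (u , s) ∈ visits 0 x xs
    visit u = visits-cover (covers u)

    time : Fin n → ℕ
    time u = proj₁ (visit u)

    code : Fin n → Vec Bool K
    code u = cycleCode K (time u)

    time≤K+K : ∀ u → time u ≤ K + K
    time≤K+K u = begin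
      time u  ≤⟨ m+n≤o⇒n≤o (D u x) (visits-end x (proj₂ (visit u))) ⟩
      L + 0   ≡⟨ +-identityʳ L ⟩
      L       ≤⟨ n≤⌈n/2⌉+⌈n/2⌉ L ⟩
      K + K   ∎
      where open ≤-Reasoning

    separated-≼ : ∀ u v → (u , time u) ≼ (v , time v) → D u v ≤ hamming (code u) (code v)
    separated-≼ u v u≼v = ≤-hamming-cycleCode {K} u≼v around (time≤K+K v)
      where
      around : D u v + time v ≤ K + K + time u
      around = begin
        D u v + time v  ≡⟨ cong (_+ time v) (D-sym u v) ⟩
        D v u + time v  ≤⟨ visits-wrap (proj₂ (visit u)) (proj₂ (visit v)) ⟩
        L + time u      ≤⟨ +-monoˡ-≤ (time u) (n≤⌈n/2⌉+⌈n/2⌉ L) ⟩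
        K + K + time u  ∎
        where open ≤-Reasoning

    separated : IsAddressing D code
    separated u v with visits-comparable (proj₂ (visit u)) (proj₂ (visit v))
    ... | inj₁ u≼v = separated-≼ u v u≼v
    ... | inj₂ v≼u = subst₂ _≤_ (D-sym v u) (hamming-comm (code v) (code u)) (separated-≼ v u v≼u)

  addressing-from-tour : (tour : List (Fin n)) → (∀ u → u ∈ tour) →
    Σ (Fin n → Vec Bool ⌈ cycleCost D tour /2⌉) (IsAddressing D)
  addressing-from-tour []       covers = (λ _ → []) , λ u _ → ⊥-elim (∉[] (covers u))
  addressing-from-tour (x ∷ xs) covers rewrite cycleCost≡walkLength x xs =
    addressing-from-closed-walk x xs covers

corollary2 : (n : ℕ) (G : WGraph n) → 3 ≤ n → WeightMinimal G → Connected G →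
    (D : Fin n → Fin n → ℕ) → IsDistance G D →
    (h : ℕ) → IsMinHamiltonCost D h →
    Σ ℕ λ m → m ≤ ⌈ h /2⌉ × Σ (Fin n → Vec Bool m) λ f → IsAddressing D f
corollary2 n G _ _ _ D isD _ ((tour , hamiltonian , refl) , _) =
  ⌈ cycleCost D tour /2⌉ , ≤-refl , addressing-from-tour tour covers
  where
  open Distance G D isD
  open TourAddressing D distance-definite distance-sym distance-triangle

  covers : ∀ u → u ∈ tour
  covers u = ∈-resp-↭ (↭-sym hamiltonian) (∈-allFin u)
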